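{- Let $\mathcal{P}$ be a probabilistic term rewrite system (PTRS) and let $\mathfrak{T}$ be a $\to_{\mathcal{P}}$-rewrite sequence tree (RST) of height $\operatorname{h}(\mathfrak{T}) > 0$ whose root is labeled with the term $t$, such that for every leaf $v$ of $\mathfrak{T}$ there exist a context $C_v$ and a substitution $\sigma_v$ with $t_v = C_v[t\sigma_v]$, where $t_v$ is the term labeling $v$. Then $\mathcal{P}$ is neither almost-surely terminating (AST) nor positively almost-surely terminating (PAST).
   Context: Terms are built over a finite signature $\Sigma$ and an infinite set of variables $\mathcal{V}$; $\mathcal{T}$ is the set of terms. A substitution $\sigma$ maps variables to terms, has finite domain $\{x \mid x\sigma \neq x\}$, and is extended homomorphically to terms. $\operatorname{Pos}(s)$ is the set of positions of $s$, $s|_\pi$ is the subterm at $\pi$, and $s[r]_\pi$ is $s$ with the subterm at $\pi$ replaced by $r$. A context $C$ is a term with exactly one occurrence of a hole $\Box$; $C[s]$ replaces the hole by $s$. A finite multi-distribution on a set $A$ is a finite multiset of pairs $(p:a)$ with $0<p\le 1$, $a\in A$, and probabilities summing to $1$. A PTRS is a finite set of rules $\ell \to \{p_1:r_1,\dots,p_k:r_k\}$ where $\ell\notin\mathcal{V}$ and every variable of each $r_j$ occurs in $\ell$. It induces the relation $s \to_{\mathcal{P}} \{p_1:s[r_1\sigma]_\pi,\dots,p_k:s[r_k\sigma]_\pi\}$ whenever $s|_\pi = \ell\sigma$ for such a rule, a position $\pi$ and a substitution $\sigma$. More generally a probabilistic abstract reduction system (PARS) on a set $A$ is a relation $\to$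 between elements of $A$ and finite multi-distributions on $A$. A $\to$-RST is a (possibly infinite) tree whose nodes $v$ are labeled by pairs $(p_v : a_v)$ with $p_v\in(0,1]$, $a_v \in A$, the root has $p=1$, and every non-leaf node $v$ with children $w_1,\dots,w_k$ satisfies $a_v \to \{\tfrac{p_{w_1}}{p_v}:a_{w_1},\dots,\tfrac{p_{w_k}}{p_v}:a_{w_k}\}$ (leaves need not be normal forms). The depth $\operatorname{d}(v)$ is the distance from the root, and the height is $\operatorname{h}(\mathfrak{T})=\sup_v \operatorname{d}(v)\in\mathbb{N}\cup\{\omega\}$. The termination probability is $|\mathfrak{T}| = \sum_{v \text{ leaf}} p_v$; the expected derivation length is $\operatorname{edl}(\mathfrak{T})=\infty$ if $|\mathfrak{T}|<1$ and $\sum_{v\text{ leaf}}\operatorname{d}(v)\cdot p_v$ otherwise. A PARS (in particular a PTRS) is AST if $|\mathfrak{T}|=1$ for every $\to$-RST $\mathfrak{T}$, and PAST if $\operatorname{edl}(\mathfrak{T})<\infty$ for every $\to$-RST $\mathfrak{T}$.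
   Formalization: The PTRS $\mathcal{P}$ has only rational rule probabilities, and the node probabilities of rewrite sequence trees are likewise taken in ℚ. -}

module Defs where

open import Data.Nat as ℕ using (ℕ; zero; suc)
open import Data.Fin using (Fin)
open import Data.Vec using (Vec; []; _∷_; _++_)
open import Data.List as List using (List; []; _∷_; map; upTo; length)
open import Data.List.Membership.Propositional using (_∈_)
open import Data.List.Relation.Unary.All using (All)
open import Data.List.Relation.Unary.Unique.Propositional using (Unique)
open import Data.List.Relation.Binary.Pointwise using (Pointwise)
open import Data.List.Relation.Binary.Permutation.Propositional using (_↭_)
open import Data.Maybe using (Maybe; just; nothing)
open import Data.Product using (Σ; ∃; _×_; _,_; proj₁; proj₂)
open import Data.Rational as ℚ using (ℚ; 0ℚ; 1ℚ; _+_; _*_; _-_; _<_; _≤_)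
open import Data.Integer using (+_)
open import Relation.Binary.PropositionalEquality using (_≡_; subst)
open import Relation.Nullary using (¬_)

record Signature : Set where
  field
    size  : ℕ
    arity : Fin size → ℕ

module _ (Sig : Signature) where
  open Signature Sig

  data Term : Set where
    var : ℕ → Term
    fun : (f : Fin size) → Vec Term (arity f) → Term

  mutual
    vars : Term → List ℕ
    vars (var x)    = x ∷ []
    vars (fun f ts) = varsV ts

    varsV : ∀ {n} → Vec Term n → List ℕ
    varsV []       = []
    varsV (t ∷ ts) = vars t List.++ varsV ts

  isVar : Term → Set
  isVar t = ∃ λ x → t ≡ var x

  mutual
    _⟨_⟩ : Term → (ℕ → Term) → Term
    var x ⟨ σ ⟩    = σ x
    fun f ts ⟨ σ ⟩ = fun f (appV ts σ)

    appV : ∀ {n} → Vec Term n → (ℕ → Term) → Vec Term n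
    appV []       σ = []
    appV (t ∷ ts) σ = (t ⟨ σ ⟩) ∷ appV ts σ

  record Subst : Set where
    field
      map-of  : ℕ → Term
      finite  : ∃ λ (dom : List ℕ) → ∀ x → ¬ (x ∈ dom) → map-of x ≡ var x

  _·_ : Term → Subst → Term
  t · σ = t ⟨ Subst.map-of σ ⟩

  -- positions are lists of argument indices (0-based); s|π
  mutual
    _∣_ : Term → List ℕ → Maybe Term
    t ∣ []                = just t
    var x ∣ (i ∷ π)       = nothing
    fun f ts ∣ (i ∷ π)    = subV ts i π

    subV : ∀ {n} → Vec Term n → ℕ → List ℕ → Maybe Term
    subV []       i       π = nothing
    subV (t ∷ ts) zero    π = t ∣ π
    subV (t ∷ ts) (suc i) π = subV ts i π

  -- s[r]_π  (nothing iff π ∉ Pos(s))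
  mutual
    _[_]at_ : Term → Term → List ℕ → Maybe Term
    s [ r ]at []               = just r
    var x [ r ]at (i ∷ π)      = nothing
    fun f ts [ r ]at (i ∷ π)   with repV ts r i π
    ... | just ts' = just (fun f ts')
    ... | nothing  = nothing

    repV : ∀ {n} → Vec Term n → Term → ℕ → List ℕ → Maybe (Vec Term n)
    repV []       r i       π = nothing
    repV (t ∷ ts) r zero    π with t [ r ]at π
    ... | just t' = just (t' ∷ ts)
    ... | nothing = nothing
    repV (t ∷ ts) r (suc i) π with repV ts r i π
    ... | just ts' = just (t ∷ ts')
    ... | nothing  = nothing

  data Ctx : Set where
    □   : Ctx
    fun : (f : Fin size) {m k : ℕ} → Vec Term m → Ctx → Vec Term k →
          m ℕ.+ suc k ≡ arity f → Ctx

  _[_] : Ctx → Term → Term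
  □ [ s ] = s
  fun f l C r eq [ s ] = fun f (subst (Vec Term) eq (l ++ (C [ s ]) ∷ r))

-- Finite multi-distributions (as lists; multiset equality is _↭_)

sumℚ : List ℚ → ℚ
sumℚ = List.foldr _+_ 0ℚ

IsMultiDist : {A : Set} → List (ℚ × A) → Set
IsMultiDist μ = All (λ pa → (0ℚ < proj₁ pa) × (proj₁ pa ≤ 1ℚ)) μ
              × sumℚ (map proj₁ μ) ≡ 1ℚ

module _ (Sig : Signature) where

  record Rule : Set where
    field
      lhs     : Term Sig
      rhs     : List (ℚ × Term Sig)
      lhsNonVar : ¬ isVar Sig lhs
      rhsDist : IsMultiDist rhs
      varCond : All (λ pr → ∀ x → x ∈ vars Sig (proj₂ pr) → x ∈ vars Sig lhs) rhs

  PTRS : Set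
  PTRS = List Rule

  _⊢_⟶_ : PTRS → Term Sig → List (ℚ × Term Sig) → Set
  P ⊢ s ⟶ μ =
    ∃ λ (ρ : Rule) → ρ ∈ P ×
    ∃ λ (π : List ℕ) → ∃ λ (σ : Subst Sig) →
      (_∣_ Sig s π ≡ just (_·_ Sig (Rule.lhs ρ) σ)) ×
      ∃ λ (ν : List (ℚ × Term Sig)) →
        Pointwise (λ pr qs → (proj₁ pr ≡ proj₁ qs) ×
                             (_[_]at_ Sig s (_·_ Sig (proj₂ pr) σ) π ≡ just (proj₂ qs)))
                  (Rule.rhs ρ) ν
        × (ν ↭ μ)

-- A (possibly infinite, finitely branching) tree is given by the number
-- of children and the label of every address; addresses are reversed
-- paths: the i-th child of v is (i ∷ v), the root is [].

module _ {A : Set} (_⟶_ : A → List (ℚ × A) → Set) where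

  record Tree : Set where
    field
      children : List ℕ → ℕ
      prob     : List ℕ → ℚ
      label    : List ℕ → A

  data Node (T : Tree) : List ℕ → Set where
    root  : Node T []
    child : ∀ {v i} → Node T v → i ℕ.< Tree.children T v → Node T (i ∷ v)

  IsLeaf : Tree → List ℕ → Set
  IsLeaf T v = Node T v × Tree.children T v ≡ 0

  depth : List ℕ → ℕ
  depth = length

  record RST : Set where
    field
      tree     : Tree
    open Tree tree
    field
      rootProb : prob [] ≡ 1ℚ
      probRange : ∀ v → Node tree v → (0ℚ < prob v) × (prob v ≤ 1ℚ)
      -- a_v → { p_{w_1}/p_v : a_{w_1}, …, p_{w_k}/p_v : a_{w_k} }
      -- (q i is the ratio p_{w_i}/p_v, written multiplicatively)
      step : ∀ v → Node tree v → 0 ℕ.< children v →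
             ∃ λ (q : ℕ → ℚ) →
               (∀ i → i ℕ.< children v → prob (i ∷ v) ≡ q i * prob v) ×
               (label v ⟶ map (λ i → q i , label (i ∷ v)) (upTo (children v)))

  open RST public

  LeafList : RST → List (List ℕ) → Set
  LeafList 𝔗 ls = Unique ls × All (IsLeaf (tree 𝔗)) ls

  leafProbSum : RST → List (List ℕ) → ℚ
  leafProbSum 𝔗 ls = sumℚ (map (Tree.prob (tree 𝔗)) ls)

  ℕtoℚ : ℕ → ℚ
  ℕtoℚ n = (+ n) ℚ./ 1

  leafDepthSum : RST → List (List ℕ) → ℚ
  leafDepthSum 𝔗 ls = sumℚ (map (λ v → ℕtoℚ (depth v) * Tree.prob (tree 𝔗) v) ls)

  -- |𝔗| = 1 : the (countable) sum of p_v over all leaves equals 1,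
  -- i.e. the supremum of its finite partial sums is 1.
  TermProbOne : RST → Set
  TermProbOne 𝔗 =
    (∀ ls → LeafList 𝔗 ls → leafProbSum 𝔗 ls ≤ 1ℚ) ×
    (∀ ε → 0ℚ < ε → ∃ λ ls → LeafList 𝔗 ls × (1ℚ - ε < leafProbSum 𝔗 ls))

  EdlFinite : RST → Set
  EdlFinite 𝔗 = TermProbOne 𝔗 ×
    ∃ λ (B : ℚ) → ∀ ls → LeafList 𝔗 ls → leafDepthSum 𝔗 ls ≤ B

  AST : Set
  AST = ∀ (𝔗 : RST) → TermProbOne 𝔗

  PAST : Set
  PAST = ∀ (𝔗 : RST) → EdlFinite 𝔗

  HeightPos : RST → Set
  HeightPos 𝔗 = ∃ λ v → Node (tree 𝔗) v × 0 ℕ.< depth v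

{-# OPTIONS --safe #-}

-- Since →_P is closed under contexts and substitutions, every leaf t_v = C_v[tσ_v]
-- of 𝔗 can be extended by the copy C_v[𝔗σ_v] of 𝔗, whose root is not a leaf because
-- h(𝔗) > 0. Grafting copies onto the leaves of the copies forever gives an RST
-- without leaves, so its termination probability is 0: P is not AST, hence not PAST.

module Submission where

open import Algebra.Bundles using (CommutativeMonoid)
open import Data.List using (List; []; _∷_; _++_; map; upTo)
open import Data.List.Membership.Propositional using (_∈_)
open import Data.List.Membership.Propositional.Properties using (∈-++⁺ˡ; ∈-++⁺ʳ; ∈-upTo⁻)
open import Data.List.Properties using (map-∘; map-cong-local)
open import Data.List.Relation.Binary.Pointwise using (Pointwise; []; _∷_)
import Data.List.Relation.Binary.Permutation.Propositional.Properties as ↭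
open import Data.List.Relation.Unary.All as All using (_∷_)
open import Data.Maybe using (Maybe; just)
open import Data.Nat using (ℕ; zero; suc; _+_; _<_; z<s)
open import Data.Nat.Properties using (_≟_; _<?_; <-irrelevant; <-irrefl; <-≤-trans; n≢0⇒n>0)
open import Data.Product using (∃; _×_; _,_; proj₁; proj₂; map₂)
open import Data.Rational as ℚ using (ℚ; 0ℚ; 1ℚ; _*_)
import Data.Rational.Properties as ℚ
open import Data.Vec as Vec using (Vec; []; _∷_)
open import Function using (_∘′_)
open import Relation.Binary.PropositionalEquality hiding ([_])
open import Relation.Nullary using (¬_; yes; no; contradiction)

open import Algebra.Properties.CommutativeSemigroup
  (CommutativeMonoid.commutativeSemigroup ℚ.*-1-commutativeMonoid) using (x∙yz≈y∙xz)

open import Defs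
  hiding (Term; Ctx; Subst; _⟨_⟩; appV; _·_; _∣_; subV; _[_]at_; repV; _[_]; _⊢_⟶_)

IsProb : ℚ → Set
IsProb p = 0ℚ ℚ.< p × p ℚ.≤ 1ℚ

1-isProb : IsProb 1ℚ
1-isProb = ℚ.positive⁻¹ 1ℚ , ℚ.≤-refl

*-isProb : ∀ {p q} → IsProb p → IsProb q → IsProb (p * q)
*-isProb {p} {q} (0<p , p≤1) (0<q , q≤1) =
  ℚ.positive⁻¹ (p * q) {{ℚ.pos*pos⇒pos p {{ℚ.positive 0<p}} q {{ℚ.positive 0<q}}}} ,
  ℚ.≤-trans (ℚ.≤-trans (ℚ.*-monoˡ-≤-nonNeg p {{ℚ.pos⇒nonNeg p {{ℚ.positive 0<p}}}} q≤1)
                       (ℚ.≤-reflexive (ℚ.*-identityʳ p)))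
            p≤1

module _ {A : Set} {_⟶_ : A → List (ℚ × A) → Set} where

  nonroot⇒root-nonleaf : ∀ {T i v} → Node _⟶_ T (i ∷ v) → 0 < Tree.children T []
  nonroot⇒root-nonleaf (child root         i<n) = <-≤-trans z<s i<n
  nonroot⇒root-nonleaf (child (child v p) _)    = nonroot⇒root-nonleaf (child v p)

  HeightPos⇒root-nonleaf : (𝔗 : RST _⟶_) → HeightPos _⟶_ 𝔗 → 0 < Tree.children (tree 𝔗) []
  HeightPos⇒root-nonleaf 𝔗 (_ ∷ _ , node , _) = nonroot⇒root-nonleaf node

  leafless⇒¬TermProbOne : (𝔗 : RST _⟶_) →
    (∀ v → Node _⟶_ (tree 𝔗) v → 0 < Tree.children (tree 𝔗) v) → ¬ TermProbOne _⟶_ 𝔗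
  leafless⇒¬TermProbOne 𝔗 inner (_ , approx) with approx 1ℚ (proj₁ 1-isProb)
  -- 1ℚ - 1ℚ and the empty sum both compute to 0ℚ.
  ... | []    , _                       , 0<0 = ℚ.<-irrefl refl 0<0
  ... | v ∷ _ , (_ , (node , ≡0) ∷ _) , _   = <-irrefl (sym ≡0) (inner v node)

  PAST⇒AST : PAST _⟶_ → AST _⟶_
  PAST⇒AST past 𝔗 = proj₁ (past 𝔗)

module Terms (Sig : Signature) where
  open Defs.Subst public using (map-of)

  Term : Set
  Term = Defs.Term Sig

  Ctx : Set
  Ctx = Defs.Ctx Sig

  Subst : Set
  Subst = Defs.Subst Sig

  infixl 30 _⟨_⟩ _·_ _[_] _⟨_⟩ᶜ

  _⟨_⟩ : Term → (ℕ → Term) → Term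
  _⟨_⟩ = Defs._⟨_⟩ Sig

  appV : ∀ {n} → Vec Term n → (ℕ → Term) → Vec Term n
  appV = Defs.appV Sig

  _·_ : Term → Subst → Term
  _·_ = Defs._·_ Sig

  _∣_ : Term → List ℕ → Maybe Term
  _∣_ = Defs._∣_ Sig

  subV : ∀ {n} → Vec Term n → ℕ → List ℕ → Maybe Term
  subV = Defs.subV Sig

  _[_]at_ : Term → Term → List ℕ → Maybe Term
  _[_]at_ = Defs._[_]at_ Sig

  repV : ∀ {n} → Vec Term n → Term → ℕ → List ℕ → Maybe (Vec Term n)
  repV = Defs.repV Sig

  _[_] : Ctx → Term → Term
  _[_] = Defs._[_] Sig

  _⊙_ : (ℕ → Term) → (ℕ → Term) → ℕ → Term
  (τ ⊙ σ) x = τ x ⟨ σ ⟩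

  mutual
    ⟨⟩-⊙ : ∀ s τ σ → s ⟨ τ ⟩ ⟨ σ ⟩ ≡ s ⟨ τ ⊙ σ ⟩
    ⟨⟩-⊙ (var x)    τ σ = refl
    ⟨⟩-⊙ (fun f ts) τ σ = cong (fun f) (appV-⊙ ts τ σ)

    appV-⊙ : ∀ {n} (ts : Vec Term n) τ σ → appV (appV ts τ) σ ≡ appV ts (τ ⊙ σ)
    appV-⊙ []       τ σ = refl
    appV-⊙ (t ∷ ts) τ σ = cong₂ _∷_ (⟨⟩-⊙ t τ σ) (appV-⊙ ts τ σ)

  _⊙ₛ_ : Subst → Subst → Subst
  τ ⊙ₛ σ = record { map-of = map-of τ ⊙ map-of σ ; finite = domτ ++ domσ , outside }
    where
    open Defs.Subst τ using () renaming (finite to finiteτ)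
    open Defs.Subst σ using () renaming (finite to finiteσ)

    domτ domσ : List ℕ
    domτ = proj₁ finiteτ
    domσ = proj₁ finiteσ

    outside : ∀ x → ¬ x ∈ domτ ++ domσ → (map-of τ ⊙ map-of σ) x ≡ var x
    outside x x∉ rewrite proj₂ finiteτ x (x∉ ∘′ ∈-++⁺ˡ) =
      proj₂ finiteσ x (x∉ ∘′ ∈-++⁺ʳ domτ)

  idₛ : Subst
  idₛ = record { map-of = var ; finite = [] , λ _ _ → refl }

  mutual
    ∣-⟨⟩ : ∀ s π σ {u} → s ∣ π ≡ just u → s ⟨ σ ⟩ ∣ π ≡ just (u ⟨ σ ⟩)
    ∣-⟨⟩ s          []      σ refl = refl
    ∣-⟨⟩ (var x)    (i ∷ π) σ ()
    ∣-⟨⟩ (fun f ts) (i ∷ π) σ eq   = subV-appV ts i π σ eq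

    subV-appV : ∀ {n} (ts : Vec Term n) i π σ {u} → subV ts i π ≡ just u →
                subV (appV ts σ) i π ≡ just (u ⟨ σ ⟩)
    subV-appV []       i       π σ ()
    subV-appV (t ∷ ts) zero    π σ eq = ∣-⟨⟩ t π σ eq
    subV-appV (t ∷ ts) (suc i) π σ eq = subV-appV ts i π σ eq

  mutual
    []at-⟨⟩ : ∀ s r π σ {s′} → s [ r ]at π ≡ just s′ →
              s ⟨ σ ⟩ [ r ⟨ σ ⟩ ]at π ≡ just (s′ ⟨ σ ⟩)
    []at-⟨⟩ s          r []      σ refl = refl
    []at-⟨⟩ (var x)    r (i ∷ π) σ ()
    []at-⟨⟩ (fun f ts) r (i ∷ π) σ eq with repV ts r i π in rep
    []at-⟨⟩ (fun f ts) r (i ∷ π) σ refl | just ts′ rewrite repV-appV ts r i π σ rep = refl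

    repV-appV : ∀ {n} (ts : Vec Term n) r i π σ {us} → repV ts r i π ≡ just us →
                repV (appV ts σ) (r ⟨ σ ⟩) i π ≡ just (appV us σ)
    repV-appV []       r i       π σ ()
    repV-appV (t ∷ ts) r zero    π σ eq with t [ r ]at π in rep
    repV-appV (t ∷ ts) r zero    π σ refl | just t′ rewrite []at-⟨⟩ t r π σ rep = refl
    repV-appV (t ∷ ts) r (suc i) π σ eq with repV ts r i π in rep
    repV-appV (t ∷ ts) r (suc i) π σ refl | just ts′ rewrite repV-appV ts r i π σ rep = refl

  plugV : ∀ {m k n} → m + suc k ≡ n → Vec Term m → Term → Vec Term k → Vec Term n
  plugV eq l x r = subst (Vec Term) eq (l Vec.++ x ∷ r)

  hole : Ctx → List ℕ
  hole □                    = []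
  hole (fun f {m} l C r eq) = m ∷ hole C

  infixr 9 _∘ᶜ_

  _∘ᶜ_ : Ctx → Ctx → Ctx
  □              ∘ᶜ D = D
  fun f l C r eq ∘ᶜ D = fun f l (C ∘ᶜ D) r eq

  []-∘ᶜ : ∀ C D s → (C ∘ᶜ D) [ s ] ≡ C [ D [ s ] ]
  []-∘ᶜ □              D s = refl
  []-∘ᶜ (fun f l C r eq) D s = cong (λ u → fun f (plugV eq l u r)) ([]-∘ᶜ C D s)

  _⟨_⟩ᶜ : Ctx → (ℕ → Term) → Ctx
  □              ⟨ σ ⟩ᶜ = □
  fun f l C r eq ⟨ σ ⟩ᶜ = fun f (appV l σ) (C ⟨ σ ⟩ᶜ) (appV r σ) eq

  appV-plugV : ∀ {m k n} (eq : m + suc k ≡ n) l x r σ →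
               appV (plugV eq l x r) σ ≡ plugV eq (appV l σ) (x ⟨ σ ⟩) (appV r σ)
  appV-plugV refl []      x r σ = refl
  appV-plugV refl (y ∷ l) x r σ = cong (y ⟨ σ ⟩ ∷_) (appV-plugV refl l x r σ)

  []-⟨⟩ : ∀ C s σ → C [ s ] ⟨ σ ⟩ ≡ C ⟨ σ ⟩ᶜ [ s ⟨ σ ⟩ ]
  []-⟨⟩ □                s σ = refl
  []-⟨⟩ (fun f l C r eq) s σ = cong (fun f) (begin
    appV (plugV eq l (C [ s ]) r) σ
      ≡⟨ appV-plugV eq l (C [ s ]) r σ ⟩
    plugV eq (appV l σ) (C [ s ] ⟨ σ ⟩) (appV r σ)
      ≡⟨ cong (λ u → plugV eq (appV l σ) u (appV r σ)) ([]-⟨⟩ C s σ) ⟩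
    plugV eq (appV l σ) (C ⟨ σ ⟩ᶜ [ s ⟨ σ ⟩ ]) (appV r σ)
      ∎)
    where open ≡-Reasoning

  subV-plugV : ∀ {m k n} (eq : m + suc k ≡ n) l x r π → subV (plugV eq l x r) m π ≡ x ∣ π
  subV-plugV refl []      x r π = refl
  subV-plugV refl (y ∷ l) x r π = subV-plugV refl l x r π

  ∣-[] : ∀ C s π → C [ s ] ∣ (hole C ++ π) ≡ s ∣ π
  ∣-[] □                s π = refl
  ∣-[] (fun f l C r eq) s π = trans (subV-plugV eq l (C [ s ]) r (hole C ++ π)) (∣-[] C s π)

  repV-plugV : ∀ {m k n} (eq : m + suc k ≡ n) l x r u π {x′} → x [ u ]at π ≡ just x′ →
               repV (plugV eq l x r) u m π ≡ just (plugV eq l x′ r)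
  repV-plugV refl []      x r u π rep rewrite rep = refl
  repV-plugV refl (y ∷ l) x r u π rep rewrite repV-plugV refl l x r u π rep = refl

  []at-[] : ∀ C s r π {s′} → s [ r ]at π ≡ just s′ →
            C [ s ] [ r ]at (hole C ++ π) ≡ just (C [ s′ ])
  []at-[] □                s r π rep = rep
  []at-[] (fun f l C r eq) s u π rep
    rewrite repV-plugV eq l (C [ s ]) r u (hole C ++ π) ([]at-[] C s u π rep) = refl

  embed : Ctx → Subst → Term → Term
  embed C σ u = C [ u · σ ]

  infix 4 _⊵_

  _⊵_ : Term → Term → Set
  s ⊵ t = ∃ λ C → ∃ λ σ → s ≡ embed C σ t

  embed-embed : ∀ C σ D τ u →
                embed C σ (embed D τ u) ≡ embed (C ∘ᶜ D ⟨ map-of σ ⟩ᶜ) (τ ⊙ₛ σ) u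
  embed-embed C σ D τ u = begin
    C [ D [ u · τ ] · σ ]
      ≡⟨ cong (C [_]) ([]-⟨⟩ D (u · τ) (map-of σ)) ⟩
    C [ D ⟨ map-of σ ⟩ᶜ [ u · τ · σ ] ]
      ≡⟨ cong (λ w → C [ D ⟨ map-of σ ⟩ᶜ [ w ] ]) (⟨⟩-⊙ u _ _) ⟩
    C [ D ⟨ map-of σ ⟩ᶜ [ u · (τ ⊙ₛ σ) ] ]
      ≡⟨ []-∘ᶜ C _ _ ⟨
    (C ∘ᶜ D ⟨ map-of σ ⟩ᶜ) [ u · (τ ⊙ₛ σ) ]
      ∎
    where open ≡-Reasoning

  ∣-embed : ∀ C σ s π {u} → s ∣ π ≡ just u → embed C σ s ∣ (hole C ++ π) ≡ just (u · σ)
  ∣-embed C σ s π eq = trans (∣-[] C (s · σ) π) (∣-⟨⟩ s π (map-of σ) eq)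

  []at-embed : ∀ C σ s r π {s′} → s [ r ]at π ≡ just s′ →
               embed C σ s [ r · σ ]at (hole C ++ π) ≡ just (embed C σ s′)
  []at-embed C σ s r π eq = []at-[] C (s · σ) (r · σ) π ([]at-⟨⟩ s r π (map-of σ) eq)

module Rewriting (Sig : Signature) (P : PTRS Sig) where
  open Terms Sig

  _⟶_ : Term → List (ℚ × Term) → Set
  _⟶_ = Defs._⊢_⟶_ Sig P

  ⟶-embed : ∀ C σ {s μ} → s ⟶ μ → embed C σ s ⟶ map (map₂ (embed C σ)) μ
  ⟶-embed C σ {s} (ρ , ρ∈P , π , τ , redex , ν , contracta , ν↭μ) =
    ρ , ρ∈P , hole C ++ π , τ ⊙ₛ σ , redex′ ,
    map (map₂ (embed C σ)) ν , contracta′ contracta , ↭.map⁺ _ ν↭μ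
    where
    open Rule ρ using (lhs)

    redex′ : embed C σ s ∣ (hole C ++ π) ≡ just (lhs · (τ ⊙ₛ σ))
    redex′ = trans (∣-embed C σ s π redex) (cong just (⟨⟩-⊙ lhs _ _))

    contractum′ : ∀ r {u} → s [ r · τ ]at π ≡ just u →
                  embed C σ s [ r · (τ ⊙ₛ σ) ]at (hole C ++ π) ≡ just (embed C σ u)
    contractum′ r rep = subst (λ r′ → embed C σ s [ r′ ]at (hole C ++ π) ≡ _) (⟨⟩-⊙ r _ _)
                              ([]at-embed C σ s (r · τ) π rep)

    contracta′ : ∀ {rs us} →
      Pointwise (λ (p , r) (q , u) → p ≡ q × s [ r · τ ]at π ≡ just u) rs us →
      Pointwise (λ (p , r) (q , u) →
                   p ≡ q × embed C σ s [ r · (τ ⊙ₛ σ) ]at (hole C ++ π) ≡ just u)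
                rs (map (map₂ (embed C σ)) us)
    contracta′ []                                 = []
    contracta′ {(_ , r) ∷ _} ((p≡q , rep) ∷ rest) =
      (p≡q , contractum′ r rep) ∷ contracta′ rest

  module Unfolding
    (𝔗 : RST _⟶_)
    (root-nonleaf : 0 < Tree.children (tree 𝔗) [])
    (leaf-instance : ∀ v → IsLeaf _⟶_ (tree 𝔗) v →
                     Tree.label (tree 𝔗) v ⊵ Tree.label (tree 𝔗) [])
    where
    open Tree (tree 𝔗)

    -- A cursor points at the node addr of a copy of 𝔗 that has been embedded
    -- by ctx and sub and whose probabilities are scaled by weight.
    record Cursor : Set where
      field
        ctx           : Ctx
        sub           : Subst
        weight        : ℚ
        addr          : List ℕ
        node          : Node _⟶_ (tree 𝔗) addr
        inner         : 0 < children addr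
        weight-isProb : IsProb weight
    open Cursor

    embedAt : Cursor → Term → Term
    embedAt c = embed (ctx c) (sub c)

    termAt : Cursor → Term
    termAt c = embedAt c (label (addr c))

    probAt : Cursor → ℚ
    probAt c = weight c * prob (addr c)

    start : Cursor
    start = record
      { ctx = □ ; sub = idₛ ; weight = 1ℚ ; addr = [] ; node = root
      ; inner = root-nonleaf ; weight-isProb = 1-isProb }

    restart : (c : Cursor) (v : List ℕ) → IsLeaf _⟶_ (tree 𝔗) v → Cursor
    restart c v leaf@(v-node , _) = record
      { ctx = ctx c ∘ᶜ D ⟨ map-of (sub c) ⟩ᶜ ; sub = τ ⊙ₛ sub c ; weight = weight c * prob v
      ; addr = [] ; node = root ; inner = root-nonleaf
      ; weight-isProb = *-isProb (weight-isProb c) (probRange 𝔗 v v-node) }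
      where
      D : Ctx
      D = proj₁ (leaf-instance v leaf)

      τ : Subst
      τ = proj₁ (proj₂ (leaf-instance v leaf))

    restart-termAt : ∀ c v leaf → termAt (restart c v leaf) ≡ embedAt c (label v)
    restart-termAt c v leaf with leaf-instance v leaf
    ... | D , τ , v≡Dτ = begin
      embed (ctx c ∘ᶜ D ⟨ map-of (sub c) ⟩ᶜ) (τ ⊙ₛ sub c) (label [])
        ≡⟨ embed-embed (ctx c) (sub c) D τ (label []) ⟨
      embedAt c (embed D τ (label []))
        ≡⟨ cong (embedAt c) v≡Dτ ⟨
      embedAt c (label v)
        ∎
      where open ≡-Reasoning

    restart-probAt : ∀ c v leaf → probAt (restart c v leaf) ≡ weight c * prob v
    restart-probAt c v leaf = trans (cong (weight c * prob v *_) (rootProb 𝔗)) (ℚ.*-identityʳ _)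

    descend : (c : Cursor) (i : ℕ) → i < children (addr c) → Cursor
    descend c i i<n with children (i ∷ addr c) ≟ 0
    ... | no ≢0  = record c { addr = i ∷ addr c ; node = child (node c) i<n ; inner = n≢0⇒n>0 ≢0 }
    ... | yes ≡0 = restart c (i ∷ addr c) (child (node c) i<n , ≡0)

    descend-termAt : ∀ c i i<n → termAt (descend c i i<n) ≡ embedAt c (label (i ∷ addr c))
    descend-termAt c i i<n with children (i ∷ addr c) ≟ 0
    ... | no _   = refl
    ... | yes ≡0 = restart-termAt c (i ∷ addr c) (child (node c) i<n , ≡0)

    descend-probAt : ∀ c i i<n → probAt (descend c i i<n) ≡ weight c * prob (i ∷ addr c)
    descend-probAt c i i<n with children (i ∷ addr c) ≟ 0
    ... | no _   = refl
    ... | yes ≡0 = restart-probAt c (i ∷ addr c) (child (node c) i<n , ≡0)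

    -- Tree fields are total on addresses.
    move : Cursor → ℕ → Cursor
    move c i with i <? children (addr c)
    ... | yes i<n = descend c i i<n
    ... | no  _   = c

    move-descend : ∀ c {i} (i<n : i < children (addr c)) → move c i ≡ descend c i i<n
    move-descend c {i} i<n with i <? children (addr c)
    ... | yes i<n′ = cong (descend c i) (<-irrelevant i<n′ i<n)
    ... | no  i≮n  = contradiction i<n i≮n

    cursor : List ℕ → Cursor
    cursor []      = start
    cursor (i ∷ v) = move (cursor v) i

    cursor-step : ∀ c → ∃ λ q →
      (∀ i → i < children (addr c) → probAt (move c i) ≡ q i * probAt c) ×
      (termAt c ⟶ map (λ i → q i , termAt (move c i)) (upTo (children (addr c))))
    cursor-step c with step 𝔗 (addr c) (node c) (inner c)
    ... | q , prob-split , rewrites =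
      q , prob-split′ , subst (termAt c ⟶_) children-terms (⟶-embed (ctx c) (sub c) rewrites)
      where
      prob-split′ : ∀ i → i < children (addr c) → probAt (move c i) ≡ q i * probAt c
      prob-split′ i i<n = begin
        probAt (move c i)                 ≡⟨ cong probAt (move-descend c i<n) ⟩
        probAt (descend c i i<n)          ≡⟨ descend-probAt c i i<n ⟩
        weight c * prob (i ∷ addr c)      ≡⟨ cong (weight c *_) (prob-split i i<n) ⟩
        weight c * (q i * prob (addr c))  ≡⟨ x∙yz≈y∙xz (weight c) (q i) _ ⟩
        q i * probAt c                    ∎
        where open ≡-Reasoning

      child-term : ∀ {i} → i ∈ upTo (children (addr c)) →
                   map₂ (embedAt c) (q i , label (i ∷ addr c)) ≡ (q i , termAt (move c i))
      child-term {i} i∈ = cong (q i ,_) (sym (begin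
        termAt (move c i)           ≡⟨ cong termAt (move-descend c (∈-upTo⁻ i∈)) ⟩
        termAt (descend c i _)      ≡⟨ descend-termAt c i _ ⟩
        embedAt c (label (i ∷ addr c)) ∎))
        where open ≡-Reasoning

      children-terms :
        map (map₂ (embedAt c)) (map (λ i → q i , label (i ∷ addr c)) (upTo (children (addr c))))
        ≡ map (λ i → q i , termAt (move c i)) (upTo (children (addr c)))
      children-terms = trans (sym (map-∘ _)) (map-cong-local (All.tabulate child-term))

    unfold : RST _⟶_
    unfold = record
      { tree      = record { children = λ v → children (addr (cursor v))
                           ; prob     = λ v → probAt (cursor v)
                           ; label    = λ v → termAt (cursor v) }
      ; rootProb  = trans (ℚ.*-identityˡ _) (rootProb 𝔗)
      ; probRange = λ v _ → *-isProb (weight-isProb (cursor v)) (probRange 𝔗 _ (node (cursor v)))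
      ; step      = λ v _ _ → cursor-step (cursor v) }

    unfold-leafless : ∀ v → 0 < Tree.children (tree unfold) v
    unfold-leafless v = inner (cursor v)

open Defs using (Ctx; Subst; _[_]; _·_; _⊢_⟶_)

theorem4 : (Sig : Signature) (P : PTRS Sig)
           (𝔗 : RST (_⊢_⟶_ Sig P)) →
           HeightPos (_⊢_⟶_ Sig P) 𝔗 →
           (∀ (v : List ℕ) → IsLeaf (_⊢_⟶_ Sig P) (tree 𝔗) v →
             ∃ λ (C : Ctx Sig) → ∃ λ (σ : Subst Sig) →
               Tree.label (tree 𝔗) v ≡ _[_] Sig C (_·_ Sig (Tree.label (tree 𝔗) []) σ)) →
           ¬ AST (_⊢_⟶_ Sig P) × ¬ PAST (_⊢_⟶_ Sig P)
theorem4 Sig P 𝔗 height>0 leaf-instance = ¬ast , ¬ast ∘′ PAST⇒AST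
  where
  open Rewriting.Unfolding Sig P 𝔗 (HeightPos⇒root-nonleaf 𝔗 height>0) leaf-instance

  ¬ast : ¬ AST (_⊢_⟶_ Sig P)
  ¬ast ast = leafless⇒¬TermProbOne unfold (λ v _ → unfold-leafless v) (ast unfold)
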